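{- Let $k\in\mathbb{Z}^+$, let $\alpha,\beta,\delta\in\mathbb{Z}$ with $\delta>0$, and let $f(r)=(\alpha\cdot r+\beta)/\delta$ for $r\in\mathbb{Z}$. Set $\alpha'=2^k\cdot\alpha/\delta+1$, $\varepsilon=\delta-2^k\cdot\alpha\%\delta$ and $\beta'=-\min\{\alpha'\cdot r-2^k\cdot f(r)\,;\,r\in[0,\delta[\}$. For $r\in[0,\delta[$ define $q(r)=\min\{p\in\mathbb{Z}^+\,;\,\varepsilon\cdot p+\alpha'\cdot r+\beta'-2^k\cdot f(r)\ge 2^k\}$ and $M(r)=\delta\cdot q(r)+r$, and let $N=\min\{M(r)\,;\,r\in[0,\delta[\}$. Then $(\alpha\cdot r+\beta)/\delta=(\alpha'\cdot r+\beta')/2^k$ for all $r\in[0,N[$.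
   Context: For $n,\delta\in\mathbb{Z}$ with $\delta\neq0$, $n/\delta$ and $n\%\delta$ denote the quotient and remainder of Euclidean division: the unique integers $q,s$ with $n=q\cdot\delta+s$ and $0\le s<|\delta|$. The operators $\cdot$, $/$, $\%$ have equal precedence and associate left to right (so e.g. $2^k\cdot\alpha/\delta=(2^k\cdot\alpha)/\delta$). $\mathbb{Z}^+=\{x\in\mathbb{Z}: x\ge0\}$. For integers $a,b$, $[a,b[$ denotes $\{r\in\mathbb{Z}: a\le r<b\}$. -}

module Defs where

open import Level using (Level)
open import Data.Nat as ℕ using (ℕ; _^_; NonZero)
open import Data.Nat.Properties using (m^n≢0)
open import Data.Integer as ℤ using (ℤ)

2^k≢0 : ∀ k → NonZero (2 ^ k)
2^k≢0 k = m^n≢0 2 k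

IsLeastℤ : (ℤ → Set) → ℤ → Set
IsLeastℤ P m = P m × (∀ x → P x → m ℤ.≤ x)
  where open import Data.Product using (_×_)

-- m is the least element of the set P ⊆ ℕ (= ℤ⁺)
IsLeastℕ : (ℕ → Set) → ℕ → Set
IsLeastℕ P m = P m × (∀ x → P x → m ℕ.≤ x)
  where open import Data.Product using (_×_)

{-# OPTIONS --safe #-}
-- Write r = s + t δ with s ∈ [0, δ[. Then f(r) = α t + f(s), and since α' δ = 2^k α + ε,
--   α' r + β' = 2^k f(r) + (ε t + α' s + β' - 2^k f(s)).
-- The choice of β' makes this drift nonnegative, while r < N ≤ δ q(s) + s forces t < q(s),
-- so by minimality of q(s) the drift is below 2^k; hence (α' r + β') / 2^k = f(r).
module Submission where

open import Defs
open import Data.Nat using (ℕ; _^_; NonZero)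
open import Data.Integer using (ℤ; +_; _+_; _-_; _*_; -_; _/_; _%_; _≤_; _<_; _≥_; 0ℤ; 1ℤ)
open import Data.Product using (Σ; _×_; _,_)
open import Relation.Binary.PropositionalEquality using (_≡_)

import Data.Nat as ℕ
import Data.Nat.Properties as ℕ
import Data.Nat.DivMod as ℕ
open import Data.Integer using (suc; +≤+; +<+)
open import Data.Integer.Properties
open import Data.Integer.DivMod using (a≡a%n+[a/n]*n; a≡a%ℕn+[a/ℕn]*n; n%d<d)
open import Data.Integer.Tactic.RingSolver using (solve-∀)
open import Data.Product using (proj₁; proj₂)
open import Relation.Binary.PropositionalEquality using (refl; sym; trans; cong; subst; module ≡-Reasoning)

module _ (d : ℕ) .{{_ : NonZero d}} where

  quotient-≤ : ∀ {q q' y y'} → 0ℤ ≤ y → y' < + d → + d * q + y ≡ + d * q' + y' → q ≤ q'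
  quotient-≤ {q} {q'} {y} {y'} 0≤y y'<d eq =
    subst (q ≤_) (pred-suc q') (i<j⇒i≤pred[j] (*-cancelˡ-<-nonNeg (+ d) dq<d[1+q']))
    where
    open ≤-Reasoning
    dq<d[1+q'] : + d * q < + d * suc q'
    dq<d[1+q'] = begin-strict
      + d * q           ≡⟨ +-identityʳ (+ d * q) ⟨
      + d * q + 0ℤ      ≤⟨ +-monoʳ-≤ (+ d * q) 0≤y ⟩
      + d * q + y       ≡⟨ eq ⟩
      + d * q' + y'     <⟨ +-monoʳ-< (+ d * q') y'<d ⟩
      + d * q' + + d    ≡⟨ +-comm (+ d * q') (+ d) ⟩
      + d + + d * q'    ≡⟨ *-suc (+ d) q' ⟨
      + d * suc q'      ∎

  quotient-unique : ∀ {q q' y y'} → 0ℤ ≤ y → y < + d → 0ℤ ≤ y' → y' < + d →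
                    + d * q + y ≡ + d * q' + y' → q ≡ q'
  quotient-unique 0≤y y<d 0≤y' y'<d eq =
    ≤-antisym (quotient-≤ 0≤y y'<d eq) (quotient-≤ 0≤y' y<d (sym eq))

  d*t+s<d*q+s⇒t<q : ∀ {s t q} → + d * + t + s < + d * + q + s → t ℕ.< q
  d*t+s<d*q+s⇒t<q {s} {t} {q} lt = ℕ.≰⇒> λ q≤t →
    <-irrefl refl (<-≤-trans lt (+-monoˡ-≤ s (*-monoˡ-≤-nonNeg (+ d) (+≤+ q≤t))))

  a≡d*[a/d]+a%d : ∀ a → a ≡ + d * (a / + d) + + (a % + d)
  a≡d*[a/d]+a%d a = trans (a≡a%n+[a/n]*n a (+ d)) (regroup (+ (a % + d)) (a / + d) (+ d))
    where
    regroup : ∀ r q d → r + q * d ≡ d * q + r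
    regroup = solve-∀

  /-unique : ∀ {a c y} → 0ℤ ≤ y → y < + d → a ≡ + d * c + y → a / + d ≡ c
  /-unique {a} 0≤y y<d a≡dc+y =
    quotient-unique (+≤+ ℕ.z≤n) (+<+ (n%d<d a (+ d))) 0≤y y<d (trans (sym (a≡d*[a/d]+a%d a)) a≡dc+y)

  [d*c+a]/d≡c+a/d : ∀ c a → (+ d * c + a) / + d ≡ c + a / + d
  [d*c+a]/d≡c+a/d c a = /-unique (+≤+ ℕ.z≤n) (+<+ (n%d<d a (+ d))) (begin
    + d * c + a                                   ≡⟨ cong (_+_ (+ d * c)) (a≡d*[a/d]+a%d a) ⟩
    + d * c + (+ d * (a / + d) + + (a % + d))     ≡⟨ regroup (+ d) c (a / + d) (+ (a % + d)) ⟩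
    + d * (c + a / + d) + + (a % + d)             ∎)
    where
    open ≡-Reasoning
    regroup : ∀ d c q r → d * c + (d * q + r) ≡ d * (c + q) + r
    regroup = solve-∀

  [a/d+1]*d≡a+[d-a%d] : ∀ a → (a / + d + 1ℤ) * + d ≡ a + (+ d - + (a % + d))
  [a/d+1]*d≡a+[d-a%d] a =
    trans (regroup (a / + d) (+ d) (+ (a % + d))) (cong (_+ (+ d - + (a % + d))) (sym (a≡a%n+[a/n]*n a (+ d))))
    where
    regroup : ∀ q d r → (q + 1ℤ) * d ≡ (r + q * d) + (d - r)
    regroup = solve-∀

module Rescaling (K α β : ℤ) (δ : ℕ) .{{_ : NonZero δ}} where

  D : ℤ
  D = + δ

  f : ℤ → ℤ
  f r = (α * r + β) / D

  α' : ℤ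
  α' = K * α / D + 1ℤ

  ε : ℤ
  ε = D - + (K * α % D)

  0≤ε : 0ℤ ≤ ε
  0≤ε = i≤j⇒0≤j-i (<⇒≤ (+<+ (n%d<d (K * α) D)))

  f-shift : ∀ s t → f (s + t * D) ≡ α * t + f s
  f-shift s t = trans (cong (_/ D) (regroup α s t D β)) ([d*c+a]/d≡c+a/d δ (α * t) (α * s + β))
    where
    regroup : ∀ a s t d b → a * (s + t * d) + b ≡ d * (a * t) + (a * s + b)
    regroup = solve-∀

  -- The quantity compared with K in the definition of q(s), at p = t.
  drift : ℤ → ℤ → ℤ → ℤ
  drift β' s t = ε * t + α' * s + β' - K * f s

  drift-nonneg : ∀ {m} s t → m ≤ α' * s - K * f s → 0ℤ ≤ drift (- m) s (+ t)
  drift-nonneg {m} s t m≤ = subst (0ℤ ≤_) (sym (regroup ε (+ t) α' s m K (f s)))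
    (+-mono-≤ (*-monoʳ-≤-nonNeg (+ t) 0≤ε) (i≤j⇒0≤j-i m≤))
    where
    regroup : ∀ e t a s b k y → e * t + a * s + - b - k * y ≡ e * t + ((a * s - k * y) - b)
    regroup = solve-∀

  affine-split : ∀ β' s t → α' * (s + t * D) + β' ≡ K * f (s + t * D) + drift β' s t
  affine-split β' s t = begin
    α' * (s + t * D) + β'                  ≡⟨ expand α' s t D β' ⟩
    α' * s + t * (α' * D) + β'             ≡⟨ cong (λ z → α' * s + t * z + β') ([a/d+1]*d≡a+[d-a%d] δ (K * α)) ⟩
    α' * s + t * (K * α + ε) + β'          ≡⟨ collect α' s t K α ε β' (f s) ⟩
    K * (α * t + f s) + drift β' s t       ≡⟨ cong (λ z → K * z + drift β' s t) (f-shift s t) ⟨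
    K * f (s + t * D) + drift β' s t       ∎
    where
    open ≡-Reasoning
    expand : ∀ a s t d b → a * (s + t * d) + b ≡ a * s + t * (a * d) + b
    expand = solve-∀
    collect : ∀ a s t k x e b y → a * s + t * (k * x + e) + b ≡ k * (x * t + y) + (e * t + a * s + b - k * y)
    collect = solve-∀

theorem2 : (k : ℕ) (α β : ℤ) (δ : ℕ) .{{_ : NonZero δ}} →
    let D = + δ
        K = + (2 ^ k)
        f = λ (r : ℤ) → (α * r + β) / D
        α' = K * α / D + 1ℤ
        ε = D - + (K * α % D)
    in (m : ℤ) →
       IsLeastℤ (λ v → Σ ℤ λ r → (0ℤ ≤ r × r < D) × v ≡ α' * r - K * f r) m →
       let β' = - m in
       (q : ℤ → ℕ) →
       (∀ r → 0ℤ ≤ r → r < D → IsLeastℕ (λ p → ε * + p + α' * r + β' - K * f r ≥ K) (q r)) →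
       (N : ℤ) →
       IsLeastℤ (λ v → Σ ℤ λ r → (0ℤ ≤ r × r < D) × v ≡ D * + q r + r) N →
       ∀ r → 0ℤ ≤ r → r < N → (α * r + β) / D ≡ _/_ (α' * r + β') K {{2^k≢0 k}}
theorem2 k α β δ m (_ , m-least) q q-least N (_ , N-least) (+ n) _ r<N =
  subst (λ r → f r ≡ _/_ (α' * r + - m) (+ (2 ^ k)) {{2^k≢0 k}}) (sym n≡s+tD)
    (sym (/-unique (2 ^ k) {{2^k≢0 k}} 0≤Y Y<K (affine-split (- m) s (+ t))))
  where
  open Rescaling (+ (2 ^ k)) α β δ
  s = + (n ℕ.% δ)
  t = n ℕ./ δ
  n≡s+tD : + n ≡ s + + t * D
  n≡s+tD = a≡a%ℕn+[a/ℕn]*n (+ n) δ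
  s-range : 0ℤ ≤ s × s < D
  s-range = +≤+ ℕ.z≤n , +<+ (ℕ.m%n<n n δ)
  0≤Y : 0ℤ ≤ drift (- m) s (+ t)
  0≤Y = drift-nonneg s t (m-least _ (s , s-range , refl))
  t<qs : t ℕ.< q s
  t<qs = d*t+s<d*q+s⇒t<q δ (begin-strict
    D * + t + s     ≡⟨ swap s (+ t) D ⟩
    s + + t * D     ≡⟨ n≡s+tD ⟨
    + n             <⟨ r<N ⟩
    N               ≤⟨ N-least _ (s , s-range , refl) ⟩
    D * + q s + s   ∎)
    where
    open ≤-Reasoning
    swap : ∀ s t d → d * t + s ≡ s + t * d
    swap = solve-∀
  Y<K : drift (- m) s (+ t) < + (2 ^ k)
  Y<K = ≰⇒> λ K≤Y → ℕ.<⇒≱ t<qs (proj₂ (q-least s (proj₁ s-range) (proj₂ s-range)) t K≤Y)
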